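{- Let $G$ and $H$ be two graphs (possibly $G=H$) and let $C$ be the coloring produced by color refinement run on them. If $u\in V(G)$ and $v\in V(H)$ satisfy $C(u)=C(v)$, then $u\in\mathrm{core}(G)$ if and only if $v\in\mathrm{core}(H)$.
   Context: The core $\mathrm{core}(G)$ is the maximal subgraph of $G$ of minimum degree at least $2$. Color refinement: starting from a uniform coloring of the vertex set (of the disjoint union when two graphs are given), iteratively set $C_i(x)=(C_{i-1}(x),\{\!\{C_{i-1}(y):y\in N(x)\}\!\})$ until the color partition stabilizes, giving $C$. -}

module Defs where

open import Data.Nat using (ℕ; zero; suc; _+_; _≤_)
open import Data.Bool using (Bool; true; false; _∧_; T)
open import Data.Fin using (Fin; splitAt)
open import Data.List using (List; length; filterᵇ; allFin)
open import Data.List.Relation.Binary.Pointwise using (Pointwise)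
open import Data.List.Relation.Binary.Permutation.Propositional using (_↭_)
open import Data.Sum using (_⊎_; inj₁; inj₂)
open import Data.Product using (Σ; ∃; _×_)
open import Data.Unit using (⊤)
open import Relation.Binary.PropositionalEquality using (_≡_)

record Graph (n : ℕ) : Set where
  field
    adj   : Fin n → Fin n → Bool
    sym   : ∀ x y → adj x y ≡ adj y x
    irrefl : ∀ x → adj x x ≡ false
open Graph public

-- Disjoint union of G and H, vertex set Fin (n + m):
-- vertices of G are  u ↑ˡ m , vertices of H are  n ↑ʳ v.
unionAdj : ∀ {n m} → Graph n → Graph m → Fin (n + m) → Fin (n + m) → Bool
unionAdj {n} {m} G H x y with splitAt n x | splitAt n y
... | inj₁ a | inj₁ b = adj G a b
... | inj₂ a | inj₂ b = adj H a b
... | inj₁ _ | inj₂ _ = false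
... | inj₂ _ | inj₁ _ = false

neighbours : ∀ {k} → (Fin k → Fin k → Bool) → Fin k → List (Fin k)
neighbours A x = filterᵇ (A x) (allFin _)

-- Color refinement, presented via the equivalence relations of its colorings:
-- SameColor A i x y  means  C_i(x) = C_i(y).
-- C_0 is uniform; C_{i+1}(x) = C_{i+1}(y) iff C_i(x) = C_i(y) and the
-- multisets {{C_i(z) : z ∈ N(x)}} and {{C_i(z) : z ∈ N(y)}} coincide, i.e. some
-- rearrangement of the neighbour list of y matches that of x pointwise in C_i-color.
SameColor : ∀ {k} → (Fin k → Fin k → Bool) → ℕ → Fin k → Fin k → Set
SameColor A zero x y = ⊤
SameColor A (suc i) x y =
  SameColor A i x y ×
  ∃ λ (ys : List _) → (neighbours A y ↭ ys) × Pointwise (SameColor A i) (neighbours A x) ys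

-- Stable coloring C: the color partitions refine each other, so C(x) = C(y)
-- iff C_i(x) = C_i(y) for every i (the iteration stabilizes at the intersection).
StableSameColor : ∀ {k} → (Fin k → Fin k → Bool) → Fin k → Fin k → Set
StableSameColor A x y = ∀ i → SameColor A i x y

degIn : ∀ {n} → Graph n → (Fin n → Bool) → Fin n → ℕ
degIn G S v = length (filterᵇ (λ y → S y ∧ adj G v y) (allFin _))

MinDeg2 : ∀ {n} → Graph n → (Fin n → Bool) → Set
MinDeg2 G S = ∀ v → T (S v) → 2 ≤ degIn G S v

-- v ∈ core(G): the core (maximal subgraph of min degree ≥ 2) is the union of
-- all subgraphs of min degree ≥ 2, so v lies in it iff v lies in some such subgraph.
InCore : ∀ {n} → Graph n → Fin n → Set
InCore G v = Σ (_ → Bool) λ S → T (S v) × MinDeg2 G S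

-- A vertex lies in the core iff it survives every round of pruning, where one round deletes
-- all vertices with fewer than two surviving neighbours: a set of minimum degree at least 2
-- is never touched, and the pruning stabilises (the surviving set can shrink only finitely
-- often) at a set of minimum degree at least 2. Whether a vertex survives i rounds depends
-- only on its i-th colour, since its count of surviving neighbours is read off the multiset
-- of neighbour colours. Pruning the disjoint union prunes G and H independently, so equal
-- stable colours of u and v give the same survival pattern, hence the claim.
module Submission where

open import Defs hiding (sym)
open import Data.Bool using (Bool; true; false; _∧_; T; T?)
open import Data.Bool.Properties using (∧-zeroʳ; ∧-identityʳ; T-∧)
open import Data.Empty using (⊥-elim)
open import Data.Fin using (Fin; zero; suc; _↑ˡ_; _↑ʳ_)
open import Data.Fin.Properties using (splitAt-↑ˡ; splitAt-↑ʳ)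
open import Data.List using (List; []; _∷_; _++_; length; map; filterᵇ; tabulate; allFin)
open import Data.List.Properties using (map-tabulate; length-++; filter-++; filter-≐; filter-none; length-filter; filter-complete)
open import Data.List.Membership.Propositional.Properties using (∈-allFin; ∈-filter⁺)
open import Data.List.Relation.Unary.All as All using (All)
open import Data.List.Relation.Unary.All.Properties using (all-filter)
open import Data.List.Relation.Binary.Pointwise as Pointwise using (Pointwise; Pointwise-length)
open import Data.List.Relation.Binary.Permutation.Propositional.Properties using (↭-length; filter-↭)
open import Data.List.Relation.Binary.Sublist.Propositional using (⊆-refl)
open import Data.List.Relation.Binary.Sublist.Propositional.Properties as Sublist using (length-mono-≤)
open import Data.Nat using (ℕ; zero; suc; _+_; _≤_; _≤ᵇ_; _≟_)
open import Data.Nat.Properties using (+-identityʳ; ≤-trans; ≤∧≢⇒<; ≤ᵇ⇒≤; ≤⇒≤ᵇ; n≮0; ≤-pred)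
open import Data.Product using (∃-syntax; _,_)
open import Function.Base using (_∘_; id)
open import Function.Bundles using (_⇔_; mk⇔; Equivalence)
import Function.Properties.Equivalence as ⇔
open import Relation.Binary.PropositionalEquality using (_≡_; refl; sym; trans; cong; cong₂; subst; subst₂; module ≡-Reasoning)
open import Relation.Nullary using (yes; no)

private
  variable
    X Y : Set

filterᵇ-cong : {p q : X → Bool} → (∀ x → p x ≡ q x) → ∀ xs → filterᵇ p xs ≡ filterᵇ q xs
filterᵇ-cong p≗q = filter-≐ (T? ∘ _) (T? ∘ _) ((λ {x} → subst T (p≗q x)) , (λ {x} → subst T (sym (p≗q x))))

length-filterᵇ-none : {p : X → Bool} → (∀ x → p x ≡ false) → ∀ xs → length (filterᵇ p xs) ≡ 0
length-filterᵇ-none p≗false xs =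
  cong length (filter-none (T? ∘ _) (All.universal (λ x → subst T (p≗false x)) xs))

length-filterᵇ-mono : {p q : X → Bool} → (∀ x → T (p x) → T (q x)) → ∀ xs →
  length (filterᵇ p xs) ≤ length (filterᵇ q xs)
length-filterᵇ-mono p⇒q xs =
  length-mono-≤ (Sublist.filter⁺ (T? ∘ _) (T? ∘ _) (λ { refl → p⇒q _ }) (⊆-refl {x = xs}))

filterᵇ-∧ : (p q : X → Bool) → ∀ xs → filterᵇ (λ x → p x ∧ q x) xs ≡ filterᵇ p (filterᵇ q xs)
filterᵇ-∧ p q [] = refl
filterᵇ-∧ p q (x ∷ xs) with q x
... | false rewrite ∧-zeroʳ (p x) = filterᵇ-∧ p q xs
... | true rewrite ∧-identityʳ (p x) with p x
...   | true = cong (x ∷_) (filterᵇ-∧ p q xs)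
...   | false = filterᵇ-∧ p q xs

length-filterᵇ-map : (p : Y → Bool) (f : X → Y) → ∀ xs →
  length (filterᵇ p (map f xs)) ≡ length (filterᵇ (p ∘ f) xs)
length-filterᵇ-map p f [] = refl
length-filterᵇ-map p f (x ∷ xs) with p (f x)
... | true = cong suc (length-filterᵇ-map p f xs)
... | false = length-filterᵇ-map p f xs

length-filterᵇ-Pointwise : {R : X → X → Set} {p : X → Bool} → (∀ {a b} → R a b → p a ≡ p b) →
  ∀ {xs ys} → Pointwise R xs ys → length (filterᵇ p xs) ≡ length (filterᵇ p ys)
length-filterᵇ-Pointwise p-resp rs = Pointwise-length
  (Pointwise.filter⁺ (T? ∘ _) (T? ∘ _) (λ r → subst T (p-resp r)) (λ r → subst T (sym (p-resp r))) rs)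

tabulate-+ : ∀ {n m} (f : Fin (n + m) → X) → tabulate f ≡ tabulate (f ∘ (_↑ˡ m)) ++ tabulate (f ∘ (n ↑ʳ_))
tabulate-+ {n = zero} f = refl
tabulate-+ {n = suc n} {m} f = cong (f zero ∷_) (tabulate-+ {n = n} {m} (f ∘ suc))

length-filterᵇ-allFin-+ : ∀ {n m} (p : Fin (n + m) → Bool) →
  length (filterᵇ p (allFin (n + m))) ≡
  length (filterᵇ (p ∘ (_↑ˡ m)) (allFin n)) + length (filterᵇ (p ∘ (n ↑ʳ_)) (allFin m))
length-filterᵇ-allFin-+ {n} {m} p = begin
  length (filterᵇ p (allFin (n + m)))
    ≡⟨ cong (length ∘ filterᵇ p) (tabulate-+ {n = n} {m} id) ⟩
  length (filterᵇ p (tabulate (_↑ˡ m) ++ tabulate (n ↑ʳ_)))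
    ≡⟨ cong length (filter-++ (T? ∘ p) (tabulate (_↑ˡ m)) _) ⟩
  length (filterᵇ p (tabulate (_↑ˡ m)) ++ filterᵇ p (tabulate (n ↑ʳ_)))
    ≡⟨ length-++ (filterᵇ p (tabulate (_↑ˡ m))) ⟩
  length (filterᵇ p (tabulate (_↑ˡ m))) + length (filterᵇ p (tabulate (n ↑ʳ_)))
    ≡⟨ cong₂ _+_ (count (_↑ˡ m)) (count (n ↑ʳ_)) ⟩
  length (filterᵇ (p ∘ (_↑ˡ m)) (allFin n)) + length (filterᵇ (p ∘ (n ↑ʳ_)) (allFin m)) ∎
  where
  open ≡-Reasoning
  count : ∀ {k} (f : Fin k → Fin (n + m)) → length (filterᵇ p (tabulate f)) ≡ length (filterᵇ (p ∘ f) (allFin k))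
  count f = trans (cong (length ∘ filterᵇ p) (sym (map-tabulate id f))) (length-filterᵇ-map p f (allFin _))

-- On a graph, degreeIn (adj G) is definitionally degIn G; it takes a bare adjacency function
-- because the pruning is also run on unionAdj G H.
degreeIn : ∀ {k} → (Fin k → Fin k → Bool) → (Fin k → Bool) → Fin k → ℕ
degreeIn A S x = length (filterᵇ (λ y → S y ∧ A x y) (allFin _))

alive : ∀ {k} → (Fin k → Fin k → Bool) → ℕ → Fin k → Bool
alive A zero x = true
alive A (suc i) x = (2 ≤ᵇ degreeIn A (alive A i) x) ∧ alive A i x

module _ {k} (A : Fin k → Fin k → Bool) where

  degreeIn-neighbours : ∀ S x → degreeIn A S x ≡ length (filterᵇ S (neighbours A x))
  degreeIn-neighbours S x = cong length (filterᵇ-∧ S (A x) (allFin k))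

  degreeIn-mono : ∀ {S S′} → (∀ y → T (S y) → T (S′ y)) → ∀ x → degreeIn A S x ≤ degreeIn A S′ x
  degreeIn-mono {S} {S′} S⊆S′ x =
    subst₂ _≤_ (sym (degreeIn-neighbours S x)) (sym (degreeIn-neighbours S′ x))
           (length-filterᵇ-mono S⊆S′ (neighbours A x))

  degreeIn-resp-SameColor : ∀ {i S x y} → (∀ {a b} → SameColor A i a b → S a ≡ S b) →
    SameColor A (suc i) x y → degreeIn A S x ≡ degreeIn A S y
  degreeIn-resp-SameColor {S = S} {x} {y} S-resp (_ , ys , y↭ys , x≈ys) = begin
    degreeIn A S x                       ≡⟨ degreeIn-neighbours S x ⟩
    length (filterᵇ S (neighbours A x))  ≡⟨ length-filterᵇ-Pointwise S-resp x≈ys ⟩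
    length (filterᵇ S ys)                ≡⟨ ↭-length (filter-↭ (T? ∘ S) y↭ys) ⟨
    length (filterᵇ S (neighbours A y))  ≡⟨ degreeIn-neighbours S y ⟨
    degreeIn A S y                       ∎
    where open ≡-Reasoning

  alive-resp-SameColor : ∀ i {x y} → SameColor A i x y → alive A i x ≡ alive A i y
  alive-resp-SameColor zero _ = refl
  alive-resp-SameColor (suc i) x≈y@(x≈ᵢy , _) =
    cong₂ (λ d a → (2 ≤ᵇ d) ∧ a) (degreeIn-resp-SameColor (alive-resp-SameColor i) x≈y)
                                 (alive-resp-SameColor i x≈ᵢy)

PreservesDegrees : ∀ {k l} → (Fin k → Fin k → Bool) → (Fin l → Fin l → Bool) → (Fin l → Fin k) → Set
PreservesDegrees A B ι =
  ∀ {S S′} → (∀ w → S (ι w) ≡ S′ w) → ∀ x → degreeIn A S (ι x) ≡ degreeIn B S′ x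

alive-∘ : ∀ {k l} {A : Fin k → Fin k → Bool} {B : Fin l → Fin l → Bool} {ι : Fin l → Fin k} →
  PreservesDegrees A B ι → ∀ i x → alive A i (ι x) ≡ alive B i x
alive-∘ ι-deg zero x = refl
alive-∘ ι-deg (suc i) x =
  cong₂ (λ d a → (2 ≤ᵇ d) ∧ a) (ι-deg (alive-∘ ι-deg i) x) (alive-∘ ι-deg i x)

module _ {n m} (G : Graph n) (H : Graph m) where

  private
    U = unionAdj G H

  ↑ˡ-preservesDegrees : PreservesDegrees U (adj G) (_↑ˡ m)
  ↑ˡ-preservesDegrees {S} {S′} S≡S′ u = begin
    degreeIn U S (u ↑ˡ m)
      ≡⟨ length-filterᵇ-allFin-+ {n} {m} (λ y → S y ∧ U (u ↑ˡ m) y) ⟩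
    length (filterᵇ (λ w → S (w ↑ˡ m) ∧ U (u ↑ˡ m) (w ↑ˡ m)) (allFin n)) +
    length (filterᵇ (λ w → S (n ↑ʳ w) ∧ U (u ↑ˡ m) (n ↑ʳ w)) (allFin m))
      ≡⟨ cong₂ _+_ (cong length (filterᵇ-cong (λ w → cong₂ _∧_ (S≡S′ w) (edge w)) (allFin n)))
                   (length-filterᵇ-none (λ w → trans (cong (S (n ↑ʳ w) ∧_) (no-edge w)) (∧-zeroʳ _)) (allFin m)) ⟩
    degreeIn (adj G) S′ u + 0
      ≡⟨ +-identityʳ _ ⟩
    degreeIn (adj G) S′ u ∎
    where
    open ≡-Reasoning
    edge : ∀ w → U (u ↑ˡ m) (w ↑ˡ m) ≡ adj G u w
    edge w rewrite splitAt-↑ˡ n u m | splitAt-↑ˡ n w m = refl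
    no-edge : ∀ w → U (u ↑ˡ m) (n ↑ʳ w) ≡ false
    no-edge w rewrite splitAt-↑ˡ n u m | splitAt-↑ʳ n m w = refl

  ↑ʳ-preservesDegrees : PreservesDegrees U (adj H) (n ↑ʳ_)
  ↑ʳ-preservesDegrees {S} {S′} S≡S′ v = begin
    degreeIn U S (n ↑ʳ v)
      ≡⟨ length-filterᵇ-allFin-+ {n} {m} (λ y → S y ∧ U (n ↑ʳ v) y) ⟩
    length (filterᵇ (λ w → S (w ↑ˡ m) ∧ U (n ↑ʳ v) (w ↑ˡ m)) (allFin n)) +
    length (filterᵇ (λ w → S (n ↑ʳ w) ∧ U (n ↑ʳ v) (n ↑ʳ w)) (allFin m))
      ≡⟨ cong₂ _+_ (length-filterᵇ-none (λ w → trans (cong (S (w ↑ˡ m) ∧_) (no-edge w)) (∧-zeroʳ _)) (allFin n))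
                   (cong length (filterᵇ-cong (λ w → cong₂ _∧_ (S≡S′ w) (edge w)) (allFin m))) ⟩
    degreeIn (adj H) S′ v
      ∎
    where
    open ≡-Reasoning
    edge : ∀ w → U (n ↑ʳ v) (n ↑ʳ w) ≡ adj H v w
    edge w rewrite splitAt-↑ʳ n m v | splitAt-↑ʳ n m w = refl
    no-edge : ∀ w → U (n ↑ʳ v) (w ↑ˡ m) ≡ false
    no-edge w rewrite splitAt-↑ʳ n m v | splitAt-↑ˡ n w m = refl

module _ {k} (G : Graph k) where

  private
    A = adj G

  alive-if-MinDeg2 : ∀ {S} → MinDeg2 G S → ∀ i x → T (S x) → T (alive A i x)
  alive-if-MinDeg2 minDeg zero x Sx = _
  alive-if-MinDeg2 minDeg (suc i) x Sx = Equivalence.from T-∧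
    ( ≤⇒≤ᵇ (≤-trans (minDeg x Sx) (degreeIn-mono A (λ y → alive-if-MinDeg2 minDeg i y) x))
    , alive-if-MinDeg2 minDeg i x Sx )

  survivors : ℕ → List (Fin k)
  survivors i = filterᵇ (alive A i) (allFin k)

  survivors-suc : ∀ i → survivors (suc i) ≡ filterᵇ (λ x → 2 ≤ᵇ degreeIn A (alive A i) x) (survivors i)
  survivors-suc i = filterᵇ-∧ _ (alive A i) (allFin k)

  MinDeg2-if-stalled : ∀ {i} → length (survivors (suc i)) ≡ length (survivors i) → MinDeg2 G (alive A i)
  MinDeg2-if-stalled {i} stalled x alive-x =
    ≤ᵇ⇒≤ 2 _ (All.lookup all-keep (∈-filter⁺ (T? ∘ alive A i) (∈-allFin x) alive-x))
    where
    keep : Fin k → Bool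
    keep x = 2 ≤ᵇ degreeIn A (alive A i) x
    all-keep : All (T ∘ keep) (survivors i)
    all-keep = subst (All (T ∘ keep))
      (filter-complete (T? ∘ keep) (trans (cong length (sym (survivors-suc i))) stalled))
      (all-filter (T? ∘ keep) (survivors i))

  survivors-shrink : ∀ i → length (survivors (suc i)) ≤ length (survivors i)
  survivors-shrink i =
    subst (λ xs → length xs ≤ length (survivors i)) (sym (survivors-suc i)) (length-filter _ (survivors i))

  -- b bounds the number of survivors, which drops in every round that is not stalled.
  MinDeg2-stage : ∀ b i → length (survivors i) ≤ b → ∃[ j ] MinDeg2 G (alive A j)
  MinDeg2-stage b i bound with length (survivors (suc i)) ≟ length (survivors i)
  ... | yes stalled = i , MinDeg2-if-stalled {i} stalled
  MinDeg2-stage zero i bound | no shrinks =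
    ⊥-elim (n≮0 (≤-trans (≤∧≢⇒< (survivors-shrink i) shrinks) bound))
  MinDeg2-stage (suc b) i bound | no shrinks =
    MinDeg2-stage b (suc i) (≤-pred (≤-trans (≤∧≢⇒< (survivors-shrink i) shrinks) bound))

  InCore⇔alive : ∀ {x} → InCore G x ⇔ (∀ i → T (alive A i x))
  InCore⇔alive {x} = mk⇔
    (λ (S , Sx , minDeg) i → alive-if-MinDeg2 minDeg i x Sx)
    (λ always → let j , minDeg = MinDeg2-stage _ 0 (length-filter _ (allFin k)) in alive A j , always j , minDeg)

claim4 : ∀ {n m} (G : Graph n) (H : Graph m) (u : Fin n) (v : Fin m) →
    StableSameColor (unionAdj G H) (u ↑ˡ m) (n ↑ʳ v) →
    InCore G u ⇔ InCore H v
claim4 {n} {m} G H u v u≈v =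
  ⇔.trans (InCore⇔alive G) (⇔.trans (mk⇔ (transport alive-u≡alive-v) (transport (sym ∘ alive-u≡alive-v)))
                                     (⇔.sym (InCore⇔alive H)))
  where
  alive-u≡alive-v : ∀ i → alive (adj G) i u ≡ alive (adj H) i v
  alive-u≡alive-v i = begin
    alive (adj G) i u               ≡⟨ alive-∘ (↑ˡ-preservesDegrees G H) i u ⟨
    alive (unionAdj G H) i (u ↑ˡ m) ≡⟨ alive-resp-SameColor (unionAdj G H) i (u≈v i) ⟩
    alive (unionAdj G H) i (n ↑ʳ v) ≡⟨ alive-∘ (↑ʳ-preservesDegrees G H) i v ⟩
    alive (adj H) i v               ∎
    where open ≡-Reasoning

  transport : {f g : ℕ → Bool} → (∀ i → f i ≡ g i) → (∀ i → T (f i)) → ∀ i → T (g i)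
  transport f≡g always i = subst T (f≡g i) (always i)
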